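{- Let $D=(V,A)$ be a digraph, $k\in\mathbb{N}$, and $\mathcal{B}=(\mathcal{B}_0,\dots,\mathcal{B}_{k-1})$ with $\mathcal{B}_i=(V_i,A_i)$ pairwise edge-disjoint branchings in $D$, such that for every $\varnothing\neq X\subseteq V$, $\varrho_{D\setminus\mathcal{B}}(X)\geq|\{i<k:V_i\cap X=\varnothing\}|$. Let $B_1\subseteq B_0$ be dangerous sets with $\varrho_{D\setminus\mathcal{B}}(B_0)=\varrho_{D\setminus\mathcal{B}}(B_1)=l\geq1$. Let $\{e_1,\dots,e_l\}=\mathsf{in}_{D\setminus\mathcal{B}}(B_0)$ and $s_j=\mathsf{end}(e_j)$. Then there is a system of pairwise edge-disjoint paths $\{P_j\}_{j=1}^{l}$ in $(D\setminus\mathcal{B})[B_0]$ such that $P_j$ goes from $s_j$ to $B_1$ for each $j$. Moreover, every such path system contains all elements of $\mathsf{e}_{D\setminus\mathcal{B}}(B_0\setminus B_1,B_1)$, and the multiset $\{\mathsf{end}(P_j)\}_{j=1}^{l}$ equals the multiset $\{\mathsf{end}(e):e\in\mathsf{in}_{D\setminus\mathcal{B}}(B_1)\}$.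
   Context: $D\setminus\mathcal{B}=(V,A\setminus\bigcup_{i<k}A_i)$. For a digraph $H$ and $X\subseteq V$, $\mathsf{in}_H(X)$ is the set of edges of $H$ with tail outside $X$ and head in $X$, and $\varrho_H(X)=|\mathsf{in}_H(X)|$; $\mathsf{e}_H(X,Y)$ is the set of edges of $H$ with tail in $X$ and head in $Y$; $\mathsf{end}(e)$ is the head of $e$, and $\mathsf{end}(P)$ the last vertex of $P$. $(D\setminus\mathcal{B})[B_0]$ is the subdigraph spanned by $B_0$. A branching is a digraph whose weakly connected components are arborescences; $V_i$ is the vertex set of $\mathcal{B}_i$. A set $\varnothing\neq X\subseteq V$ is tight if $\varrho_{D\setminus\mathcal{B}}(X)=|\{i<k:V_i\cap X=\varnothing\}|$ and dangerous if it is tight and $X\cap V_0\neq\varnothing$. A path (directed, simple) goes from $X$ to $Y$ if it meets $X$ only in its first vertex and $Y$ only in its last vertex; here "from $s_j$" means from $\{s_j\}$, and one-vertex paths are allowed. -}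

module Defs where

open import Data.Nat using (ℕ; _≤_; _≥_)
open import Data.Bool using (Bool; true; false; _∧_; not)
open import Data.Fin using (Fin; toℕ; _≟_)
open import Data.Fin.Subset using (Subset; ∣_∣; _∩_; ⊥)
open import Data.Fin.Properties using (all?)
open import Data.Vec using (lookup; tabulate)
open import Data.Vec.Properties using (≡-dec)
open import Data.List using (List; []; _∷_; map)
open import Data.List.Relation.Unary.All using (All)
open import Data.List.Relation.Unary.Unique.Propositional using (Unique)
open import Data.List.Membership.Propositional using () renaming (_∈_ to _∈ₗ_)
open import Data.Product using (Σ; ∃; _×_)
open import Data.Unit using (⊤)
open import Relation.Nullary using (¬_; ¬?; does)
open import Relation.Binary.PropositionalEquality using (_≡_; _≢_)
import Data.Bool.Properties as BoolP

-- A digraph D = (V, A): vertices Fin n, edges Fin m (parallel edges and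
-- loops allowed); each edge e has tail (tl e) and head (hd e).

record Digraph : Set where
  field
    n  : ℕ
    m  : ℕ
    tl : Fin m → Fin n
    hd : Fin m → Fin n
open Digraph public

_∈ᵇ_ : ∀ {p} → Fin p → Subset p → Bool
x ∈ᵇ X = lookup X x

NonEmpty : ∀ {p} → Subset p → Set
NonEmpty {p} X = ∃ λ (x : Fin p) → x ∈ᵇ X ≡ true

_⊆ˢ_ : ∀ {p} → Subset p → Subset p → Set
X ⊆ˢ Y = ∀ x → x ∈ᵇ X ≡ true → x ∈ᵇ Y ≡ true

module _ (D : Digraph) where

  Chain : Fin (n D) → List (Fin (m D)) → Set
  Chain s []       = ⊤
  Chain s (e ∷ es) = (tl D e ≡ s) × Chain (hd D e) es

  verts : Fin (n D) → List (Fin (m D)) → List (Fin (n D))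
  verts s es = s ∷ map (hd D) es

  endW : Fin (n D) → List (Fin (m D)) → Fin (n D)
  endW s []       = s
  endW s (e ∷ es) = endW (hd D e) es

  -- A branching (W, F) (F ⊆ edges with both ends in W) is a
  -- digraph whose weakly connected components are arborescences, i.e.
  -- every vertex has in-degree at most 1 in F and F has no directed cycle.

  IsBranching : Subset (n D) → Subset (m D) → Set
  IsBranching W F =
      (∀ e → e ∈ᵇ F ≡ true → (tl D e ∈ᵇ W ≡ true) × (hd D e ∈ᵇ W ≡ true))
    × (∀ e e′ → e ∈ᵇ F ≡ true → e′ ∈ᵇ F ≡ true → hd D e ≡ hd D e′ → e ≡ e′)
    × (∀ v (e : Fin (m D)) es → Chain v (e ∷ es) → All (λ f → f ∈ᵇ F ≡ true) (e ∷ es)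
         → endW v (e ∷ es) ≢ v)

  module _ {k : ℕ} (Vb : Fin k → Subset (n D)) (Ab : Fin k → Subset (m D)) where

    EdgeDisjointBranchings : Set
    EdgeDisjointBranchings =
        (∀ i → IsBranching (Vb i) (Ab i))
      × (∀ i j e → e ∈ᵇ Ab i ≡ true → e ∈ᵇ Ab j ≡ true → i ≡ j)

    remB : Fin (m D) → Bool
    remB e = does (all? (λ i → ¬? (BoolP._≟_ (e ∈ᵇ Ab i) true)))

    inB : Subset (n D) → Fin (m D) → Bool
    inB X e = remB e ∧ (not (tl D e ∈ᵇ X) ∧ (hd D e ∈ᵇ X))

    ϱ : Subset (n D) → ℕ
    ϱ X = ∣ tabulate (inB X) ∣

    missing : Subset (n D) → ℕ
    missing X = ∣ tabulate (λ i → does (≡-dec BoolP._≟_ (Vb i ∩ X) ⊥)) ∣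

    CutCondition : Set
    CutCondition = ∀ X → NonEmpty X → ϱ X ≥ missing X

    Tight : Subset (n D) → Set
    Tight X = NonEmpty X × (ϱ X ≡ missing X)

    Dangerous : Subset (n D) → Set
    Dangerous X = Tight X × Σ (Fin k) λ i → (toℕ i ≡ 0)
                    × ∃ λ v → (v ∈ᵇ Vb i ≡ true) × (v ∈ᵇ X ≡ true)

    -- es (starting at s) is a (simple, directed) path in (D∖B)[B0]
    -- going from s to B1: it meets B1 exactly in its last vertex.
    HitsOnlyAtEnd : Subset (n D) → Fin (n D) → List (Fin (m D)) → Set
    HitsOnlyAtEnd B1 s []       = s ∈ᵇ B1 ≡ true
    HitsOnlyAtEnd B1 s (e ∷ es) = (s ∈ᵇ B1 ≡ false) × HitsOnlyAtEnd B1 (hd D e) es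

    PathFromTo : Subset (n D) → Subset (n D) → Fin (n D) → List (Fin (m D)) → Set
    PathFromTo B0 B1 s es =
        Chain s es
      × All (λ e → remB e ≡ true) es
      × All (λ v → v ∈ᵇ B0 ≡ true) (verts s es)
      × Unique (verts s es)
      × HitsOnlyAtEnd B1 s es

    -- A path system: for each edge e ∈ in_{D∖B}(B0) (so s = end(e)),
    -- a path P e from end(e) to B1 in (D∖B)[B0]; pairwise edge-disjoint.
    PathSystem : Subset (n D) → Subset (n D) → (Fin (m D) → List (Fin (m D))) → Set
    PathSystem B0 B1 P =
        (∀ e → inB B0 e ≡ true → PathFromTo B0 B1 (hd D e) (P e))
      × (∀ e e′ → inB B0 e ≡ true → inB B0 e′ ≡ true → e ≢ e′
           → ∀ f → f ∈ₗ P e → ¬ (f ∈ₗ P e′))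

    endMult : Subset (n D) → (Fin (m D) → List (Fin (m D))) → Fin (n D) → ℕ
    endMult B0 P v = ∣ tabulate (λ e → inB B0 e ∧ does (endW (hd D e) (P e) ≟ v)) ∣

    headMult : Subset (n D) → Fin (n D) → ℕ
    headMult B1 v = ∣ tabulate (λ e → inB B1 e ∧ does (hd D e ≟ v)) ∣

module Submission where

open import Defs
open import Data.Nat using (ℕ; _≤_)
open import Data.Bool using (true; false)
open import Data.Fin using (Fin)
open import Data.Fin.Subset using (Subset)
open import Data.List using (List)
open import Data.List.Membership.Propositional using (_∈_)
open import Data.Product using (Σ; ∃; _×_)
open import Relation.Binary.PropositionalEquality using (_≡_)

open import Data.Nat using (zero; suc; _+_; _<_; z≤n; s≤s)
import Data.Nat as ℕ
open import Data.Nat.Properties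
  using ( ≤-reflexive; ≤-trans; ≤-antisym; ≤-pred; <-≤-trans; <-irrefl; ≤∧≢⇒<; n<1+n
        ; +-mono-≤; +-monoʳ-≤; +-monoʳ-<; +-monoˡ-<; +-cancelʳ-≤; +-cancelˡ-≡; +-commutativeSemigroup)
open import Algebra.Properties.CommutativeSemigroup +-commutativeSemigroup using (interchange; x∙yz≈y∙xz)
open import Data.Bool using (Bool; _∧_; _∨_; _xor_; not; if_then_else_)
import Data.Bool.Properties as Bool
open import Data.Fin using (zero; suc; _≟_)
open import Data.Fin.Properties using (any?; all?; suc-injective; 0≢1+n)
open import Data.Fin.Subset using (∣_∣; _∩_) renaming (⊥ to ∅; _⊆_ to _⊆ᴸ_; _∈_ to _∈ᴸ_)
open import Data.Fin.Subset.Properties using (anySubset?; ⊆-antisym; ⊆-min; x∈p∩q⁺; x∈p∩q⁻)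
open import Data.Vec using (tabulate)
open import Data.Vec.Properties using (lookup∘tabulate; ≡-dec; []=⇒lookup; lookup⇒[]=)
import Data.Vec.Functional as Vector
open import Data.List using ([]; _∷_; map; _++_)
open import Data.List.Properties using (map-++)
open import Data.List.Relation.Unary.All using (All; []; _∷_)
import Data.List.Relation.Unary.All as All
import Data.List.Relation.Unary.All.Properties as All
open import Data.List.Relation.Unary.AllPairs using ([]; _∷_)
import Data.List.Relation.Unary.AllPairs as AllPairs
open import Data.List.Relation.Unary.Any using (here; there)
open import Data.List.Relation.Unary.Unique.Propositional using (Unique)
import Data.List.Relation.Unary.Unique.Propositional.Properties as Unique
open import Data.List.Membership.Propositional using (_∉_)
open import Data.List.Membership.Propositional.Properties using (∈-++⁻)
open import Data.Product using (_,_; proj₁; proj₂)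
open import Data.Sum using (inj₁; inj₂)
open import Data.Empty using (⊥; ⊥-elim)
open import Data.Unit using (tt)
open import Function using (id; _∘_)
open import Relation.Nullary using (¬_; Dec; yes; no; does; ¬?)
open import Relation.Nullary.Decidable using (_×-dec_; _→-dec_)
open import Relation.Unary using (Decidable)
open import Relation.Binary.PropositionalEquality
  using (_≢_; refl; sym; trans; cong; cong₂; subst; subst₂; module ≡-Reasoning)

-- For an edge set E of D let ρ(X) count the edges of E entering X.  Nested
-- sets T ⊆ W form a cut pair of value l if ρ(W) = ρ(T) = l and ρ(Y) ≥ l for
-- all Y between them.  Core (linkage-exists, a Menger-type theorem): a cut
-- pair admits edge-disjoint paths inside W from the head of every edge of
-- in(W) to T.  Induction on |E| + |W ∖ T|: split at a tight set strictly
-- between T and W and concatenate (concat-linkage); else delete an edge inside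
-- W ∖ T (delete-pair); else W ∖ T has at most one vertex, since two would make
-- W − v tight by modularity (two-vertices), and single edges matched by
-- counting suffice (small-linkage).  Conversely (linkage-rigid) the edge by
-- which a route enters T gives an injection in(W) → in(T), hence a bijection,
-- which yields both "moreover" claims.  Finally (B0, B1) is a cut pair of
-- D ∖ B, and the path systems of the statement are its linkages.

true≢false : ∀ {b} → b ≡ true → b ≡ false → ⊥
true≢false refl ()

≢true : ∀ {b} → (b ≡ true → ⊥) → b ≡ false
≢true {true}  ¬b = ⊥-elim (¬b refl)
≢true {false} _  = refl

∧-true⁻ : ∀ {a b} → a ∧ b ≡ true → a ≡ true × b ≡ true
∧-true⁻ {true} b≡true = refl , b≡true

∨-trueˡ : ∀ {a} b → a ≡ true → a ∨ b ≡ true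
∨-trueˡ b refl = refl

∨-trueʳ : ∀ a {b} → b ≡ true → a ∨ b ≡ true
∨-trueʳ true  _      = refl
∨-trueʳ false b≡true = b≡true

∧-not⁻ : ∀ {a b} → a ∧ not b ≡ true → a ≡ true × b ≡ false
∧-not⁻ {true} {false} _ = refl , refl
∧-not⁻ {true} {true}  ()

∧-not⁺ : ∀ {a b} → a ≡ true → b ≡ false → a ∧ not b ≡ true
∧-not⁺ refl refl = refl

∧-not-∧⁻ : ∀ {a b c} → a ∧ (not b ∧ c) ≡ true → a ≡ true × b ≡ false × c ≡ true
∧-not-∧⁻ {true} {false} {true}  _ = refl , refl , refl
∧-not-∧⁻ {true} {true}          ()
∧-not-∧⁻ {true} {false} {false} ()

∧-not-∧⁺ : ∀ {a b c} → a ≡ true → b ≡ false → c ≡ true → a ∧ (not b ∧ c) ≡ true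
∧-not-∧⁺ refl refl refl = refl

∧-≟⁻ : ∀ {a b} (x y : Fin a) → b ∧ does (x ≟ y) ≡ true → b ≡ true × x ≡ y
∧-≟⁻ {b = true} x y h with x ≟ y
... | yes x≡y = refl , x≡y

∧-≟⁺ : ∀ {a b} {x y : Fin a} → b ≡ true → x ≡ y → b ∧ does (x ≟ y) ≡ true
∧-≟⁺ {x = x} {y} refl x≡y with x ≟ y
... | yes _   = refl
... | no  x≢y = ⊥-elim (x≢y x≡y)

⊆-trans : ∀ {p} {X Y Z : Subset p} → X ⊆ˢ Y → Y ⊆ˢ Z → X ⊆ˢ Z
⊆-trans X⊆Y Y⊆Z x x∈X = Y⊆Z x (X⊆Y x x∈X)

⊆-false : ∀ {p} {X Y : Subset p} → X ⊆ˢ Y → ∀ {x} → x ∈ᵇ Y ≡ false → x ∈ᵇ X ≡ false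
⊆-false X⊆Y {x} x∉Y = ≢true (λ x∈X → true≢false (X⊆Y x x∈X) x∉Y)

ind : Bool → ℕ
ind true  = 1
ind false = 0

count : ∀ {a} → (Fin a → Bool) → ℕ
count {zero}  p = 0
count {suc a} p = ind (p zero) + count (p ∘ suc)

count-tabulate : ∀ {a} (p : Fin a → Bool) → ∣ tabulate p ∣ ≡ count p
count-tabulate {zero}  p = refl
count-tabulate {suc a} p with p zero
... | true  = cong suc (count-tabulate (p ∘ suc))
... | false = count-tabulate (p ∘ suc)

count-cong : ∀ {a} {p q : Fin a → Bool} → (∀ x → p x ≡ q x) → count p ≡ count q
count-cong {zero}  eq = refl
count-cong {suc a} eq = cong₂ _+_ (cong ind (eq zero)) (count-cong (eq ∘ suc))

count-mono : ∀ {a} {p q : Fin a → Bool} → (∀ x → p x ≡ true → q x ≡ true) → count p ≤ count q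
count-mono {zero}      p⊆q = z≤n
count-mono {suc a} {p} {q} p⊆q = +-mono-≤ first (count-mono (p⊆q ∘ suc))
  where
  first : ind (p zero) ≤ ind (q zero)
  first with p zero | p⊆q zero
  ... | true  | holds = ≤-reflexive (cong ind (sym (holds refl)))
  ... | false | _     = z≤n

count-additive : ∀ {a} (p q r s : Fin a → Bool)
  → (∀ x → ind (p x) + ind (q x) ≡ ind (r x) + ind (s x))
  → count p + count q ≡ count r + count s
count-additive {zero}  p q r s eq = refl
count-additive {suc a} p q r s eq = begin
  (ind (p zero) + count (p ∘ suc)) + (ind (q zero) + count (q ∘ suc))
    ≡⟨ interchange (ind (p zero)) _ _ _ ⟩
  (ind (p zero) + ind (q zero)) + (count (p ∘ suc) + count (q ∘ suc))
    ≡⟨ cong₂ _+_ (eq zero) (count-additive (p ∘ suc) (q ∘ suc) (r ∘ suc) (s ∘ suc) (eq ∘ suc)) ⟩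
  (ind (r zero) + ind (s zero)) + (count (r ∘ suc) + count (s ∘ suc))
    ≡⟨ interchange (ind (r zero)) _ _ _ ⟩
  (ind (r zero) + count (r ∘ suc)) + (ind (s zero) + count (s ∘ suc)) ∎
  where open ≡-Reasoning

_─_ : ∀ {a} → (Fin a → Bool) → Fin a → Fin a → Bool
(p ─ y) x = if does (x ≟ y) then false else p x

─⁺ : ∀ {a} (p : Fin a → Bool) x y → p x ≡ true → x ≢ y → (p ─ y) x ≡ true
─⁺ p x y px x≢y with x ≟ y
... | yes x≡y = ⊥-elim (x≢y x≡y)
... | no  _   = px

─⁻ : ∀ {a} (p : Fin a → Bool) x y → (p ─ y) x ≡ true → p x ≡ true × x ≢ y
─⁻ p x y h with x ≟ y
... | no x≢y = h , x≢y

count-split : ∀ {a} (p : Fin a → Bool) (y : Fin a) → count p ≡ ind (p y) + count (p ─ y)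
count-split {suc a} p zero    = refl
count-split {suc a} p (suc y) = begin
  ind (p zero) + count (p ∘ suc)
    ≡⟨ cong (ind (p zero) +_) (count-split (p ∘ suc) y) ⟩
  ind (p zero) + (ind (p (suc y)) + count ((p ∘ suc) ─ y))
    ≡⟨ x∙yz≈y∙xz (ind (p zero)) (ind (p (suc y))) _ ⟩
  ind (p (suc y)) + (ind (p zero) + count ((p ∘ suc) ─ y)) ∎
  where open ≡-Reasoning

count-remove : ∀ {a} (p : Fin a → Bool) {y} → p y ≡ true → count p ≡ suc (count (p ─ y))
count-remove p {y} py = trans (count-split p y) (cong (λ b → ind b + count (p ─ y)) py)

count-< : ∀ {a} {p q : Fin a → Bool} {y} → (∀ x → p x ≡ true → q x ≡ true)
  → q y ≡ true → p y ≡ false → count p < count q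
count-< {p = p} {q} {y} p⊆q qy py =
  subst (count p <_) (sym (count-remove q qy)) (s≤s (count-mono below))
  where
  below : ∀ x → p x ≡ true → (q ─ y) x ≡ true
  below x px = ─⁺ q x y (p⊆q x px) (λ x≡y → true≢false px (subst (λ z → p z ≡ false) (sym x≡y) py))

count-pos : ∀ {a} (q : Fin a → Bool) → 0 < count q → ∃ λ y → q y ≡ true
count-pos {suc a} q pos with q zero in q0
... | true  = zero , q0
... | false = let (y , qy) = count-pos (q ∘ suc) pos in suc y , qy

InjectiveOn : ∀ {a b} → (Fin a → Bool) → (Fin b → Bool) → (Fin a → Fin b) → Set
InjectiveOn p q σ = (∀ x → p x ≡ true → q (σ x) ≡ true)
                  × (∀ x y → p x ≡ true → p y ≡ true → σ x ≡ σ y → x ≡ y)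

count-≤-injection : ∀ {a b} {p : Fin a → Bool} {q : Fin b → Bool}
  (σ : ∀ x → p x ≡ true → Fin b)
  → (∀ x px → q (σ x px) ≡ true)
  → (∀ x y px py → σ x px ≡ σ y py → x ≡ y)
  → count p ≤ count q
count-≤-injection {zero} σ into inj = z≤n
count-≤-injection {suc a} {p = p} {q} σ into inj with p zero in p0
... | false = count-≤-injection (σ ∘ suc) (into ∘ suc) (λ x y px py eq → suc-injective (inj _ _ px py eq))
... | true  = subst (suc (count (p ∘ suc)) ≤_) (sym (count-remove q (into zero p0)))
                (s≤s (count-≤-injection (σ ∘ suc) avoids-σ0 (λ x y px py eq → suc-injective (inj _ _ px py eq))))
  where
  avoids-σ0 : ∀ x px → (q ─ σ zero p0) (σ (suc x) px) ≡ true
  avoids-σ0 x px = ─⁺ q _ _ (into (suc x) px) (λ eq → 0≢1+n (inj _ _ p0 px (sym eq)))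

-- Conversely |p| ≤ |q| yields an injection of p into q (σ is completed
-- outside p by an arbitrary fallback map).
injection-from-≤ : ∀ {a b} (p : Fin a → Bool) (q : Fin b → Bool) → (Fin a → Fin b)
  → count p ≤ count q → Σ (Fin a → Fin b) (InjectiveOn p q)
injection-from-≤ {zero}  p q fallback _ = fallback , (λ ()) , (λ ())
injection-from-≤ {suc a} {b} p q fallback le with p zero in p0
... | false =
  let (σ , into , inj) = injection-from-≤ (p ∘ suc) q (fallback ∘ suc) le in
  (fallback zero Vector.∷ σ) ,
  (λ { zero h → ⊥-elim (true≢false h p0) ; (suc x) px → into x px }) ,
  (λ { zero _ h _ _ → ⊥-elim (true≢false h p0) ; (suc x) zero _ h _ → ⊥-elim (true≢false h p0)
     ; (suc x) (suc y) px py eq → cong suc (inj x y px py eq) })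
... | true =
  let (σ , into , inj) = injection-from-≤ (p ∘ suc) (q ─ y₀) (fallback ∘ suc) rest in
  (y₀ Vector.∷ σ) ,
  (λ { zero _ → qy₀ ; (suc x) px → proj₁ (─⁻ q _ y₀ (into x px)) }) ,
  (λ { zero zero _ _ _ → refl
     ; zero (suc y) _ py eq → ⊥-elim (proj₂ (─⁻ q _ y₀ (into y py)) (sym eq))
     ; (suc x) zero px _ eq → ⊥-elim (proj₂ (─⁻ q _ y₀ (into x px)) eq)
     ; (suc x) (suc y) px py eq → cong suc (inj x y px py eq) })
  where
  y₀ : Fin b
  y₀ = proj₁ (count-pos q (≤-trans (s≤s z≤n) le))
  qy₀ : q y₀ ≡ true
  qy₀ = proj₂ (count-pos q (≤-trans (s≤s z≤n) le))
  rest : count (p ∘ suc) ≤ count (q ─ y₀)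
  rest = ≤-pred (subst (suc (count (p ∘ suc)) ≤_) (count-remove q qy₀) le)

injection-onto : ∀ {a b} {p : Fin a → Bool} {q : Fin b → Bool} (σ : Fin a → Fin b)
  → InjectiveOn p q σ → count q ≤ count p
  → ∀ y → q y ≡ true → ∃ λ x → p x ≡ true × σ x ≡ y
injection-onto {p = p} {q} σ (into , inj) q≤p y qy with any? (λ x → (p x Bool.≟ true) ×-dec (σ x ≟ y))
... | yes found = found
... | no  missed = ⊥-elim (<-irrefl refl (<-≤-trans p<q q≤p))
  where
  p<q : count p < count q
  p<q = subst (count p <_) (sym (count-remove q qy))
          (s≤s (count-≤-injection (λ x _ → σ x)
                  (λ x px → ─⁺ q (σ x) y (into x px) (λ σx≡y → missed (x , px , σx≡y)))
                  inj))

count-bijection : ∀ {a b} {p : Fin a → Bool} {q : Fin b → Bool} (σ : Fin a → Fin b)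
  → InjectiveOn p q σ → (∀ y → q y ≡ true → ∃ λ x → p x ≡ true × σ x ≡ y)
  → count p ≡ count q
count-bijection σ (into , inj) onto = ≤-antisym
  (count-≤-injection (λ x _ → σ x) into inj)
  (count-≤-injection (λ y qy → proj₁ (onto y qy)) (λ y qy → proj₁ (proj₂ (onto y qy)))
     (λ y y′ qy qy′ eq → trans (sym (proj₂ (proj₂ (onto y qy))))
                           (trans (cong σ eq) (proj₂ (proj₂ (onto y′ qy′))))))

half-of-sum : ∀ {l a b} → l ≤ a → l ≤ b → a + b ≡ l + l → a ≡ l
half-of-sum {l} {a} {b} l≤a l≤b sum = ≤-antisym a≤l l≤a
  where
  a≤l : a ≤ l
  a≤l = +-cancelʳ-≤ b a l (≤-trans (≤-reflexive sum) (+-monoʳ-≤ l l≤b))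

-- The per-edge content of modularity: an edge is counted equally often by
-- in(A), in(B) and by in(A ∪ B), in(A ∩ B), unless both its ends lie in the
-- symmetric difference of A and B.
modular-bit : ∀ a₁ b₁ a₂ b₂ → (a₁ xor b₁ ≡ true → a₂ xor b₂ ≡ true → ⊥)
  → ind (not a₁ ∧ a₂) + ind (not b₁ ∧ b₂)
  ≡ ind (not (a₁ ∨ b₁) ∧ (a₂ ∨ b₂)) + ind (not (a₁ ∧ b₁) ∧ (a₂ ∧ b₂))
modular-bit true  true  _     _     _ = refl
modular-bit false false true  _     _ = refl
modular-bit false false false true  _ = refl
modular-bit false false false false _ = refl
modular-bit true  false true  true  _ = refl
modular-bit true  false false false _ = refl
modular-bit true  false true  false h = ⊥-elim (h refl refl)
modular-bit true  false false true  h = ⊥-elim (h refl refl)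
modular-bit false true  true  true  _ = refl
modular-bit false true  false false _ = refl
modular-bit false true  true  false h = ⊥-elim (h refl refl)
modular-bit false true  false true  h = ⊥-elim (h refl refl)

-- The per-edge content of ρ-balance below: w₁, t₁ (w₂, t₂) record whether
-- the tail (head) lies in W and in T, for nested sets T ⊆ W.
balance-bit : ∀ w₁ t₁ w₂ t₂ → (t₁ ≡ true → w₁ ≡ true) → (t₂ ≡ true → w₂ ≡ true)
  → ind (not w₁ ∧ w₂) + ind ((not t₁ ∧ t₂) ∧ w₁)
  ≡ ind (not t₁ ∧ t₂) + ind ((not w₁ ∧ w₂) ∧ not t₂)
balance-bit true  true  _     _     _ _ = refl
balance-bit true  false _     true  _ _ = refl
balance-bit true  false _     false _ _ = refl
balance-bit false true  _     _     h _ = ⊥-elim (true≢false (h refl) refl)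
balance-bit false false true  true  _ _ = refl
balance-bit false false false true  _ h = ⊥-elim (true≢false (h refl) refl)
balance-bit false false true  false _ _ = refl
balance-bit false false false false _ _ = refl

module Linkages (D : Digraph) where

  Vertex : Set
  Vertex = Fin (n D)

  Edge : Set
  Edge = Fin (m D)

  VertexSet : Set
  VertexSet = Subset (n D)

  -- Edge sets are characteristic functions; the theory is developed for an
  -- arbitrary edge set E, which is later instantiated to D ∖ B.
  EdgeSet : Set
  EdgeSet = Edge → Bool

  _∖_ : VertexSet → VertexSet → Vertex → Bool
  (W ∖ T) x = x ∈ᵇ W ∧ not (x ∈ᵇ T)

  enters : EdgeSet → VertexSet → Edge → Bool
  enters E X e = E e ∧ (not (tl D e ∈ᵇ X) ∧ (hd D e ∈ᵇ X))

  ρ : EdgeSet → VertexSet → ℕ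
  ρ E X = count (enters E X)

  enters⁻ : ∀ E X e → enters E X e ≡ true
    → E e ≡ true × tl D e ∈ᵇ X ≡ false × hd D e ∈ᵇ X ≡ true
  enters⁻ E X e = ∧-not-∧⁻ {E e} {tl D e ∈ᵇ X}

  enters-tail : ∀ E X e → enters E X e ≡ true → tl D e ∈ᵇ X ≡ false
  enters-tail E X e h = proj₁ (proj₂ (enters⁻ E X e h))

  enters⁺ : ∀ {E X e} → E e ≡ true → tl D e ∈ᵇ X ≡ false → hd D e ∈ᵇ X ≡ true
    → enters E X e ≡ true
  enters⁺ = ∧-not-∧⁺

  ∖⁺ : ∀ {W T x} → x ∈ᵇ W ≡ true → x ∈ᵇ T ≡ false → (W ∖ T) x ≡ true
  ∖⁺ = ∧-not⁺

  ∖⁻ : ∀ W T x → (W ∖ T) x ≡ true → x ∈ᵇ W ≡ true × x ∈ᵇ T ≡ false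
  ∖⁻ W T x = ∧-not⁻ {x ∈ᵇ W}

  ∖-excludes : ∀ W T {x} → x ∈ᵇ T ≡ true → (W ∖ T) x ≡ false
  ∖-excludes W T {x} x∈T = ≢true (λ h → true≢false x∈T (proj₂ (∖⁻ W T x h)))

  MeetsOnlyAtEnd : VertexSet → Vertex → List Edge → Set
  MeetsOnlyAtEnd T s []       = s ∈ᵇ T ≡ true
  MeetsOnlyAtEnd T s (e ∷ es) = s ∈ᵇ T ≡ false × MeetsOnlyAtEnd T (hd D e) es

  record Path (E : EdgeSet) (W T : VertexSet) (s : Vertex) (es : List Edge) : Set where
    field
      chain   : Chain D s es
      usesE   : All (λ e → E e ≡ true) es
      insideW : All (λ v → v ∈ᵇ W ≡ true) (verts D s es)
      simple  : Unique (verts D s es)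
      meetsT  : MeetsOnlyAtEnd T s es

  tail-∈-verts : ∀ {s es f} → Chain D s es → f ∈ es → tl D f ∈ verts D s es
  tail-∈-verts (tl≡s , _)     (here refl)  = here tl≡s
  tail-∈-verts (_    , chain) (there f∈es) = there (tail-∈-verts chain f∈es)

  tail-outside : ∀ {T s es f} → Chain D s es → MeetsOnlyAtEnd T s es → f ∈ es
    → tl D f ∈ᵇ T ≡ false
  tail-outside {T} (tl≡s , _) (s∉T , _) (here refl) = subst (λ v → v ∈ᵇ T ≡ false) (sym tl≡s) s∉T
  tail-outside (_ , chain) (_ , meets) (there f∈es) = tail-outside chain meets f∈es

  meets-end : ∀ {T s es x} → MeetsOnlyAtEnd T s es → x ∈ verts D s es → x ∈ᵇ T ≡ true
    → x ≡ endW D s es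
  meets-end {es = []}    _         (here refl)  _   = refl
  meets-end {es = []}    _         (there ())   _
  meets-end {es = _ ∷ _} (s∉T , _) (here refl)  x∈T = ⊥-elim (true≢false x∈T s∉T)
  meets-end {es = _ ∷ _} (_ , meets) (there x∈) x∈T = meets-end meets x∈ x∈T

  module _ {E : EdgeSet} {W T : VertexSet} {s : Vertex} {es : List Edge} (π : Path E W T s es) where
    open Path π

    path-tail-outside : ∀ {f} → f ∈ es → tl D f ∈ᵇ T ≡ false
    path-tail-outside = tail-outside chain meetsT

    path-tail-inside : ∀ {f} → f ∈ es → tl D f ∈ᵇ W ≡ true
    path-tail-inside f∈es = All.lookup insideW (tail-∈-verts chain f∈es)

  lastEdge : Edge → List Edge → Edge
  lastEdge d []       = d
  lastEdge d (e ∷ es) = lastEdge e es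

  lastEdge-∈ : ∀ d es → lastEdge d es ∈ d ∷ es
  lastEdge-∈ d []       = here refl
  lastEdge-∈ d (e ∷ es) = there (lastEdge-∈ e es)

  lastEdge-enters : ∀ {E T} d es → E d ≡ true → tl D d ∈ᵇ T ≡ false
    → Chain D (hd D d) es → All (λ e → E e ≡ true) es → MeetsOnlyAtEnd T (hd D d) es
    → enters E T (lastEdge d es) ≡ true × hd D (lastEdge d es) ≡ endW D (hd D d) es
  lastEdge-enters {E} {T} d [] Ed d∉T _ _ hd∈T = enters⁺ {E} {T} Ed d∉T hd∈T , refl
  lastEdge-enters {T = T} d (e ∷ es) _ _ (tl≡ , chain) (Ee ∷ usesE) (hd∉T , meets) =
    lastEdge-enters e es Ee (subst (λ v → v ∈ᵇ T ≡ false) (sym tl≡) hd∉T) chain usesE meets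

  chain-++ : ∀ {s} xs {ys} → Chain D s xs → Chain D (endW D s xs) ys → Chain D s (xs ++ ys)
  chain-++ []       _              chain₂ = chain₂
  chain-++ (x ∷ xs) (tl≡ , chain₁) chain₂ = tl≡ , chain-++ xs chain₁ chain₂

  verts-++ : ∀ s xs ys → verts D s (xs ++ ys) ≡ verts D s xs ++ map (hd D) ys
  verts-++ s xs ys = cong (s ∷_) (map-++ (hd D) xs ys)

  meets-++ : ∀ {Y T} → T ⊆ˢ Y → ∀ s xs ys → MeetsOnlyAtEnd Y s xs
    → MeetsOnlyAtEnd T (endW D s xs) ys → MeetsOnlyAtEnd T s (xs ++ ys)
  meets-++         T⊆Y s []       ys _               meets₂ = meets₂
  meets-++ {Y} {T} T⊆Y s (x ∷ xs) ys (s∉Y , meets₁) meets₂ =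
    ⊆-false {X = T} {Y} T⊆Y s∉Y , meets-++ {Y} {T} T⊆Y (hd D x) xs ys meets₁ meets₂

  path-++ : ∀ {E W Y T s xs ys} → T ⊆ˢ Y → Y ⊆ˢ W
    → Path E W Y s xs → Path E Y T (endW D s xs) ys → Path E W T s (xs ++ ys)
  path-++ {Y = Y} {T} {s} {xs} {ys} T⊆Y Y⊆W A B = record
    { chain   = chain-++ xs A.chain B.chain
    ; usesE   = All.++⁺ A.usesE B.usesE
    ; insideW = subst (All _) (sym (verts-++ s xs ys)) (All.++⁺ A.insideW (All.map (Y⊆W _) ys⊆Y))
    ; simple  = subst Unique (sym (verts-++ s xs ys)) (Unique.++⁺ A.simple (AllPairs.tail B.simple) apart)
    ; meetsT  = meets-++ {Y} {T} T⊆Y s xs ys A.meetsT B.meetsT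
    }
    where
    module A = Path A
    module B = Path B
    ys⊆Y : All (λ v → v ∈ᵇ Y ≡ true) (map (hd D) ys)
    ys⊆Y = All.tail B.insideW
    -- a common vertex would lie in Y, hence be the end of xs, which is the
    -- first vertex of the simple path ys
    apart : ∀ {v} → ¬ (v ∈ verts D s xs × v ∈ map (hd D) ys)
    apart (v∈xs , v∈ys) = All.lookup (AllPairs.head B.simple) v∈ys
                            (sym (meets-end A.meetsT v∈xs (All.lookup ys⊆Y v∈ys)))

  stay : ∀ {E W T s} → s ∈ᵇ W ≡ true → s ∈ᵇ T ≡ true → Path E W T s []
  stay s∈W s∈T = record
    { chain = tt ; usesE = [] ; insideW = s∈W ∷ [] ; simple = [] ∷ [] ; meetsT = s∈T }

  step : ∀ {E W T s g} → T ⊆ˢ W → tl D g ≡ s → E g ≡ true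
    → s ∈ᵇ W ≡ true → s ∈ᵇ T ≡ false → hd D g ∈ᵇ T ≡ true → Path E W T s (g ∷ [])
  step {T = T} {s} {g} T⊆W tl≡s Eg s∈W s∉T g∈T = record
    { chain   = tl≡s , tt
    ; usesE   = Eg ∷ []
    ; insideW = s∈W ∷ T⊆W _ g∈T ∷ []
    ; simple  = (s≢hd ∷ []) ∷ [] ∷ []
    ; meetsT  = s∉T , g∈T
    }
    where
    s≢hd : s ≢ hd D g
    s≢hd s≡hd = true≢false (subst (λ v → v ∈ᵇ T ≡ true) (sym s≡hd) g∈T) s∉T

  record Linkage (E : EdgeSet) (W T : VertexSet) (P : Edge → List Edge) : Set where
    field
      path     : ∀ e → enters E W e ≡ true → Path E W T (hd D e) (P e)
      disjoint : ∀ e e′ → enters E W e ≡ true → enters E W e′ ≡ true → e ≢ e′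
                 → ∀ f → f ∈ P e → f ∉ P e′

  -- The edge through which the route e ∷ P e enters T.
  entry : (Edge → List Edge) → Edge → Edge
  entry P e = lastEdge e (P e)

  module Entry {E W T P} (T⊆W : T ⊆ˢ W) (L : Linkage E W T P) where
    open Linkage L

    entry-enters : ∀ {e} → enters E W e ≡ true
      → enters E T (entry P e) ≡ true × hd D (entry P e) ≡ endW D (hd D e) (P e)
    entry-enters {e} e∈in =
      lastEdge-enters e (P e) (proj₁ (enters⁻ E W e e∈in)) (⊆-false {X = T} {W} T⊆W (enters-tail E W e e∈in))
                      chain usesE meetsT
      where open Path (path e e∈in)

    -- Distinct routes enter T through distinct edges: an entry edge is
    -- either the first edge e (tail outside W) or lies on P e (tail inside
    -- W), and the paths are edge-disjoint.
    entry-injective : ∀ e e′ → enters E W e ≡ true → enters E W e′ ≡ true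
      → entry P e ≡ entry P e′ → e ≡ e′
    entry-injective e e′ e∈in e′∈in same with e ≟ e′
    ... | yes e≡e′ = e≡e′
    ... | no  e≢e′ with lastEdge-∈ e (P e) | lastEdge-∈ e′ (P e′)
    ...   | here  is-e | here  is-e′ = trans (sym is-e) (trans same is-e′)
    ...   | here  is-e | there on-e′ = ⊥-elim (true≢false
              (path-tail-inside (path e′ e′∈in) (subst (_∈ P e′) (sym same) on-e′))
              (subst (λ g → tl D g ∈ᵇ W ≡ false) (sym is-e) (enters-tail E W e e∈in)))
    ...   | there on-e | here  is-e′ = ⊥-elim (true≢false
              (path-tail-inside (path e e∈in) (subst (_∈ P e) same on-e))
              (subst (λ g → tl D g ∈ᵇ W ≡ false) (sym is-e′) (enters-tail E W e′ e′∈in)))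
    ...   | there on-e | there on-e′ =
              ⊥-elim (disjoint e e′ e∈in e′∈in e≢e′ _ on-e (subst (_∈ P e′) (sym same) on-e′))

    entry-injectiveOn : InjectiveOn (enters E W) (enters E T) (entry P)
    entry-injectiveOn = (λ e e∈in → proj₁ (entry-enters e∈in)) , entry-injective

  concat-linkage : ∀ {E W Y T PA PB} → T ⊆ˢ Y → Y ⊆ˢ W
    → Linkage E W Y PA → Linkage E Y T PB → Linkage E W T (λ e → PA e ++ PB (entry PA e))
  concat-linkage {E} {W} {Y} {T} {PA} {PB} T⊆Y Y⊆W LA LB = record { path = path ; disjoint = disjoint }
    where
    module LA = Linkage LA
    module LB = Linkage LB
    open Entry Y⊆W LA

    path : ∀ e → enters E W e ≡ true → Path E W T (hd D e) (PA e ++ PB (entry PA e))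
    path e e∈in = path-++ T⊆Y Y⊆W (LA.path e e∈in)
      (subst (λ s → Path E Y T s (PB (entry PA e))) (proj₂ (entry-enters e∈in))
             (LB.path (entry PA e) (proj₁ (entry-enters e∈in))))

    -- edges of the first parts have their tails outside Y, edges of the
    -- second parts inside Y
    outside : ∀ e → enters E W e ≡ true → ∀ {f} → f ∈ PA e → tl D f ∈ᵇ Y ≡ false
    outside e e∈in = path-tail-outside (LA.path e e∈in)

    inside : ∀ e → enters E W e ≡ true → ∀ {f} → f ∈ PB (entry PA e) → tl D f ∈ᵇ Y ≡ true
    inside e e∈in = path-tail-inside (LB.path (entry PA e) (proj₁ (entry-enters e∈in)))

    disjoint : ∀ e e′ → enters E W e ≡ true → enters E W e′ ≡ true → e ≢ e′
      → ∀ f → f ∈ PA e ++ PB (entry PA e) → f ∉ PA e′ ++ PB (entry PA e′)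
    disjoint e e′ e∈in e′∈in e≢e′ f f∈ f∈′ with ∈-++⁻ (PA e) f∈ | ∈-++⁻ (PA e′) f∈′
    ... | inj₁ on-A | inj₁ on-A′ = LA.disjoint e e′ e∈in e′∈in e≢e′ f on-A on-A′
    ... | inj₁ on-A | inj₂ on-B′ = true≢false (inside e′ e′∈in on-B′) (outside e e∈in on-A)
    ... | inj₂ on-B | inj₁ on-A′ = true≢false (inside e e∈in on-B) (outside e′ e′∈in on-A′)
    ... | inj₂ on-B | inj₂ on-B′ =
      LB.disjoint (entry PA e) (entry PA e′) (proj₁ (entry-enters e∈in)) (proj₁ (entry-enters e′∈in))
        (λ same → e≢e′ (entry-injective e e′ e∈in e′∈in same)) f on-B on-B′

  linkage-restrict : ∀ {E′ E W T P} → (∀ e → E′ e ≡ true → E e ≡ true)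
    → (∀ e → enters E W e ≡ true → enters E′ W e ≡ true)
    → Linkage E′ W T P → Linkage E W T P
  linkage-restrict E′⊆E same-in L = record
    { path     = λ e e∈in → let open Path (path e (same-in e e∈in)) in record
                   { chain = chain ; usesE = All.map (E′⊆E _) usesE ; insideW = insideW
                   ; simple = simple ; meetsT = meetsT }
    ; disjoint = λ e e′ e∈in e′∈in → disjoint e e′ (same-in e e∈in) (same-in e′ e′∈in)
    }
    where open Linkage L

  -- Rigidity: if ρ_E(T) ≤ ρ_E(W), every linkage from in_E(W) to T uses every
  -- edge from W ∖ T into T, and its paths end at the heads of in_E(T) with
  -- the right multiplicities -- because the entry map is a bijection
  -- in_E(W) → in_E(T).
  linkage-rigid : ∀ {E W T P} → T ⊆ˢ W → ρ E T ≤ ρ E W → Linkage E W T P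
    → (∀ f → E f ≡ true → tl D f ∈ᵇ W ≡ true → tl D f ∈ᵇ T ≡ false → hd D f ∈ᵇ T ≡ true
         → ∃ λ e → enters E W e ≡ true × f ∈ P e)
    × (∀ v → count (λ e → enters E W e ∧ does (endW D (hd D e) (P e) ≟ v))
           ≡ count (λ f → enters E T f ∧ does (hd D f ≟ v)))
  linkage-rigid {E} {W} {T} {P} T⊆W T≤W L = covers , ends
    where
    open Entry T⊆W L
    onto : ∀ f → enters E T f ≡ true → ∃ λ e → enters E W e ≡ true × entry P e ≡ f
    onto = injection-onto (entry P) entry-injectiveOn T≤W

    covers : ∀ f → E f ≡ true → tl D f ∈ᵇ W ≡ true → tl D f ∈ᵇ T ≡ false → hd D f ∈ᵇ T ≡ true
      → ∃ λ e → enters E W e ≡ true × f ∈ P e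
    covers f Ef f∈W f∉T hd∈T with onto f (enters⁺ {E} {T} Ef f∉T hd∈T)
    ... | e , e∈in , entry≡f with lastEdge-∈ e (P e)
    ...   | here  is-e = ⊥-elim (true≢false f∈W
              (subst (λ g → tl D g ∈ᵇ W ≡ false) (trans (sym is-e) entry≡f) (enters-tail E W e e∈in)))
    ...   | there on-e = e , e∈in , subst (_∈ P e) entry≡f on-e

    ends : ∀ v → count (λ e → enters E W e ∧ does (endW D (hd D e) (P e) ≟ v))
               ≡ count (λ f → enters E T f ∧ does (hd D f ≟ v))
    ends v = count-bijection (entry P) (into , injective) onto-v
      where
      route-at : Edge → Bool
      route-at e = enters E W e ∧ does (endW D (hd D e) (P e) ≟ v)
      edge-at : Edge → Bool
      edge-at f = enters E T f ∧ does (hd D f ≟ v)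

      route-at⁻ : ∀ e → route-at e ≡ true → enters E W e ≡ true × endW D (hd D e) (P e) ≡ v
      route-at⁻ e = ∧-≟⁻ (endW D (hd D e) (P e)) v

      into : ∀ e → route-at e ≡ true → edge-at (entry P e) ≡ true
      into e h = let (e∈in , end≡v) = route-at⁻ e h ; (enters-T , hd≡end) = entry-enters e∈in in
        ∧-≟⁺ enters-T (trans hd≡end end≡v)

      injective : ∀ e e′ → route-at e ≡ true → route-at e′ ≡ true
        → entry P e ≡ entry P e′ → e ≡ e′
      injective e e′ h h′ = entry-injective e e′ (proj₁ (route-at⁻ e h)) (proj₁ (route-at⁻ e′ h′))

      onto-v : ∀ f → edge-at f ≡ true → ∃ λ e → route-at e ≡ true × entry P e ≡ f
      onto-v f h with ∧-≟⁻ (hd D f) v h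
      ... | f∈in , hd≡v with onto f f∈in
      ...   | e , e∈in , entry≡f =
        e , ∧-≟⁺ e∈in (trans (sym (proj₂ (entry-enters e∈in))) (trans (cong (hd D) entry≡f) hd≡v)) ,
        entry≡f

  ρ-modular : ∀ E (A B C I : VertexSet)
    → (∀ x → x ∈ᵇ C ≡ (x ∈ᵇ A ∨ x ∈ᵇ B)) → (∀ x → x ∈ᵇ I ≡ (x ∈ᵇ A ∧ x ∈ᵇ B))
    → (∀ f → E f ≡ true → (tl D f ∈ᵇ A) xor (tl D f ∈ᵇ B) ≡ true
                        → (hd D f ∈ᵇ A) xor (hd D f ∈ᵇ B) ≡ true → ⊥)
    → ρ E A + ρ E B ≡ ρ E C + ρ E I
  ρ-modular E A B C I C≡ I≡ no-crossing = count-additive _ _ _ _ pointwise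
    where
    pointwise : ∀ f → ind (enters E A f) + ind (enters E B f) ≡ ind (enters E C f) + ind (enters E I f)
    pointwise f rewrite C≡ (tl D f) | C≡ (hd D f) | I≡ (tl D f) | I≡ (hd D f) with E f in Ef
    ... | false = refl
    ... | true  = modular-bit (tl D f ∈ᵇ A) (tl D f ∈ᵇ B) (hd D f ∈ᵇ A) (hd D f ∈ᵇ B) (no-crossing f Ef)

  ρ-balance : ∀ E {W T} → T ⊆ˢ W
    → ρ E W + count (λ g → enters E T g ∧ tl D g ∈ᵇ W)
    ≡ ρ E T + count (λ e → enters E W e ∧ not (hd D e ∈ᵇ T))
  ρ-balance E {W} {T} T⊆W = count-additive _ _ _ _ pointwise
    where
    pointwise : ∀ e → ind (enters E W e) + ind (enters E T e ∧ tl D e ∈ᵇ W)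
                    ≡ ind (enters E T e) + ind (enters E W e ∧ not (hd D e ∈ᵇ T))
    pointwise e with E e
    ... | false = refl
    ... | true  = balance-bit (tl D e ∈ᵇ W) (tl D e ∈ᵇ T) (hd D e ∈ᵇ W) (hd D e ∈ᵇ T)
                              (T⊆W (tl D e)) (T⊆W (hd D e))

  ρ-delete : ∀ E X f → ρ E X ≡ ind (enters E X f) + ρ (E ─ f) X
  ρ-delete E X f = trans (count-split (enters E X) f) (cong (ind (enters E X f) +_) (count-cong same))
    where
    same : ∀ e → (enters E X ─ f) e ≡ enters (E ─ f) X e
    same e with e ≟ f
    ... | yes _ = refl
    ... | no  _ = refl

  ρ-delete-outside : ∀ E X f → enters E X f ≡ false → ρ (E ─ f) X ≡ ρ E X
  ρ-delete-outside E X f f∉in = sym (trans (ρ-delete E X f) (cong (λ b → ind b + ρ (E ─ f) X) f∉in))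

  -- If W ∖ T has at most one vertex and ρ(W) = ρ(T), each edge entering W
  -- at the vertex of W ∖ T is continued by its own edge from there into T;
  -- there are exactly enough such edges by ρ-balance.
  small-linkage : ∀ {E W T} → T ⊆ˢ W → ρ E W ≡ ρ E T
    → (∀ x y → (W ∖ T) x ≡ true → (W ∖ T) y ≡ true → x ≡ y) → ∃ (Linkage E W T)
  small-linkage {E} {W} {T} T⊆W ρW≡ρT single = P , record { path = path ; disjoint = disjoint }
    where
    into-gap : Edge → Bool
    into-gap e = enters E W e ∧ not (hd D e ∈ᵇ T)
    out-of-gap : Edge → Bool
    out-of-gap g = enters E T g ∧ tl D g ∈ᵇ W

    enough : count into-gap ≤ count out-of-gap
    enough = ≤-reflexive (sym (+-cancelˡ-≡ (ρ E W) _ _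
               (trans (ρ-balance E {W} {T} T⊆W) (cong (_+ count into-gap) (sym ρW≡ρT)))))

    σ : Edge → Edge
    σ = proj₁ (injection-from-≤ into-gap out-of-gap id enough)
    σ-injective : InjectiveOn into-gap out-of-gap σ
    σ-injective = proj₂ (injection-from-≤ into-gap out-of-gap id enough)

    route : Edge → Bool → List Edge
    route e true  = []
    route e false = σ e ∷ []

    P : Edge → List Edge
    P e = route e (hd D e ∈ᵇ T)

    route-path : ∀ e → enters E W e ≡ true → ∀ b → hd D e ∈ᵇ T ≡ b → Path E W T (hd D e) (route e b)
    route-path e e∈in true  hd∈T = stay (proj₂ (proj₂ (enters⁻ E W e e∈in))) hd∈T
    route-path e e∈in false hd∉T =
      let (_ , _ , hd∈W)       = enters⁻ E W e e∈in
          (g-enters , tl-g∈W) = ∧-true⁻ (proj₁ σ-injective e (∧-not⁺ e∈in hd∉T))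
          (Eg , tl-g∉T , g∈T) = enters⁻ E T (σ e) g-enters
          tl-g≡hd            = single _ _ (∖⁺ {W} {T} tl-g∈W tl-g∉T) (∖⁺ {W} {T} hd∈W hd∉T)
      in step {E} {W} {T} T⊆W tl-g≡hd Eg hd∈W hd∉T g∈T

    path : ∀ e → enters E W e ≡ true → Path E W T (hd D e) (P e)
    path e e∈in = route-path e e∈in _ refl

    on-route : ∀ e b {f} → f ∈ route e b → f ≡ σ e × b ≡ false
    on-route e false (here f≡σe) = f≡σe , refl

    disjoint : ∀ e e′ → enters E W e ≡ true → enters E W e′ ≡ true → e ≢ e′
      → ∀ f → f ∈ P e → f ∉ P e′
    disjoint e e′ e∈in e′∈in e≢e′ f f∈ f∈′ =
      let (f≡σe , hd∉T) = on-route e _ f∈ ; (f≡σe′ , hd′∉T) = on-route e′ _ f∈′ in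
      e≢e′ (proj₂ σ-injective e e′ (∧-not⁺ e∈in hd∉T) (∧-not⁺ e′∈in hd′∉T)
                                  (trans (sym f≡σe) f≡σe′))

  record CutPair (E : EdgeSet) (W T : VertexSet) (l : ℕ) : Set where
    field
      nested : T ⊆ˢ W
      ρW≡l   : ρ E W ≡ l
      ρT≡l   : ρ E T ≡ l
      cut    : ∀ Y → T ⊆ˢ Y → Y ⊆ˢ W → l ≤ ρ E Y

  StrictlyBetween : VertexSet → VertexSet → VertexSet → Set
  StrictlyBetween W T Y = T ⊆ˢ Y × Y ⊆ˢ W
                        × (∃ λ y → (Y ∖ T) y ≡ true) × (∃ λ w → (W ∖ Y) w ≡ true)

  TightBetween : EdgeSet → VertexSet → VertexSet → ℕ → VertexSet → Set
  TightBetween E W T l Y = StrictlyBetween W T Y × ρ E Y ≡ l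

  Internal : EdgeSet → VertexSet → VertexSet → Edge → Set
  Internal E W T f = E f ≡ true × (W ∖ T) (tl D f) ≡ true × (W ∖ T) (hd D f) ≡ true

  _⊆?_ : (X Y : VertexSet) → Dec (X ⊆ˢ Y)
  X ⊆? Y = all? (λ x → (x ∈ᵇ X Bool.≟ true) →-dec (x ∈ᵇ Y Bool.≟ true))

  tight-between? : ∀ E W T l → Decidable (TightBetween E W T l)
  tight-between? E W T l Y =
    ((T ⊆? Y) ×-dec (Y ⊆? W)
       ×-dec any? (λ y → (Y ∖ T) y Bool.≟ true) ×-dec any? (λ w → (W ∖ Y) w Bool.≟ true))
    ×-dec (ρ E Y ℕ.≟ l)

  internal? : ∀ E W T → Decidable (Internal E W T)
  internal? E W T f =
    (E f Bool.≟ true) ×-dec ((W ∖ T) (tl D f) Bool.≟ true) ×-dec ((W ∖ T) (hd D f) Bool.≟ true)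

  between-smaller : ∀ {W T Y} → StrictlyBetween W T Y
    → count (W ∖ Y) < count (W ∖ T) × count (Y ∖ T) < count (W ∖ T)
  between-smaller {W} {T} {Y} (T⊆Y , Y⊆W , (y , y∈Y∖T) , (w , w∈W∖Y)) =
    let (y∈Y , y∉T) = ∖⁻ Y T y y∈Y∖T ; (w∈W , w∉Y) = ∖⁻ W Y w w∈W∖Y in
    count-< W∖Y⊆W∖T (∖⁺ {W} {T} (Y⊆W y y∈Y) y∉T) (∖-excludes W Y y∈Y) ,
    count-< Y∖T⊆W∖T (∖⁺ {W} {T} w∈W (⊆-false {X = T} {Y} T⊆Y w∉Y))
                    (≢true (λ h → true≢false (proj₁ (∖⁻ Y T w h)) w∉Y))
    where
    W∖Y⊆W∖T : ∀ x → (W ∖ Y) x ≡ true → (W ∖ T) x ≡ true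
    W∖Y⊆W∖T x h = ∖⁺ {W} {T} (proj₁ (∖⁻ W Y x h)) (⊆-false {X = T} {Y} T⊆Y (proj₂ (∖⁻ W Y x h)))
    Y∖T⊆W∖T : ∀ x → (Y ∖ T) x ≡ true → (W ∖ T) x ≡ true
    Y∖T⊆W∖T x h = ∖⁺ {W} {T} (Y⊆W x (proj₁ (∖⁻ Y T x h))) (proj₂ (∖⁻ Y T x h))

  split-pair : ∀ {E W T l Y} → CutPair E W T l → TightBetween E W T l Y
    → CutPair E W Y l × CutPair E Y T l
  split-pair {W = W} {T} {Y = Y} pair ((T⊆Y , Y⊆W , _) , ρY≡l) =
    record { nested = Y⊆W ; ρW≡l = ρW≡l ; ρT≡l = ρY≡l
           ; cut = λ Z Y⊆Z Z⊆W → cut Z (⊆-trans {X = T} {Y} {Z} T⊆Y Y⊆Z) Z⊆W } ,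
    record { nested = T⊆Y ; ρW≡l = ρY≡l ; ρT≡l = ρT≡l
           ; cut = λ Z T⊆Z Z⊆Y → cut Z T⊆Z (⊆-trans {X = Z} {Y} {W} Z⊆Y Y⊆W) }
    where open CutPair pair

  -- Deleting an internal edge keeps a cut pair a cut pair when no
  -- intermediate set is tight: a set entered by f lies strictly between T
  -- and W, so its in-degree exceeds l and may drop by one.
  delete-pair : ∀ {E W T l f} → CutPair E W T l → ¬ ∃ (TightBetween E W T l)
    → Internal E W T f → CutPair (E ─ f) W T l
  delete-pair {E} {W} {T} {l} {f} pair no-tight (Ef , tl∈W∖T , hd∈W∖T) = record
    { nested = nested
    ; ρW≡l   = trans (ρ-delete-outside E W f f∉inW) ρW≡l
    ; ρT≡l   = trans (ρ-delete-outside E T f f∉inT) ρT≡l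
    ; cut    = cut′
    }
    where
    open CutPair pair
    f∉inW : enters E W f ≡ false
    f∉inW = ≢true (λ h → true≢false (proj₁ (∖⁻ W T _ tl∈W∖T)) (enters-tail E W f h))
    f∉inT : enters E T f ≡ false
    f∉inT = ≢true (λ h → true≢false (proj₂ (proj₂ (enters⁻ E T f h))) (proj₂ (∖⁻ W T _ hd∈W∖T)))
    cut′ : ∀ Y → T ⊆ˢ Y → Y ⊆ˢ W → l ≤ ρ (E ─ f) Y
    cut′ Y T⊆Y Y⊆W with enters E Y f in f-enters
    ... | false = subst (l ≤_) (sym (ρ-delete-outside E Y f f-enters)) (cut Y T⊆Y Y⊆W)
    ... | true  = ≤-pred (subst (l <_) (trans (ρ-delete E Y f) (cong (λ b → ind b + ρ (E ─ f) Y) f-enters)) l<ρY)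
      where
      strictly : StrictlyBetween W T Y
      strictly = T⊆Y , Y⊆W
        , (hd D f , ∖⁺ {Y} {T} (proj₂ (proj₂ (enters⁻ E Y f f-enters))) (proj₂ (∖⁻ W T _ hd∈W∖T)))
        , (tl D f , ∖⁺ {W} {Y} (proj₁ (∖⁻ W T _ tl∈W∖T)) (enters-tail E Y f f-enters))
      l<ρY : l < ρ E Y
      l<ρY = ≤∧≢⇒< (cut Y T⊆Y Y⊆W) (λ l≡ρY → no-tight (Y , strictly , sym l≡ρY))

  -- If W ∖ T contains two vertices u ≠ v but no edge of E runs inside W ∖ T,
  -- then X = W − v is tight: by modularity ρ(W − v) + ρ(T + v) = ρ(W) + ρ(T)
  -- = 2l, while both summands are at least l.
  two-vertices : ∀ {E W T l} → CutPair E W T l → (∀ f → ¬ Internal E W T f)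
    → ∀ u v → (W ∖ T) u ≡ true → (W ∖ T) v ≡ true → u ≢ v → ∃ (TightBetween E W T l)
  two-vertices {E} {W} {T} {l} pair no-internal u v u∈W∖T v∈W∖T u≢v =
    X , (T⊆X , X⊆W , (u , ∖⁺ {X} {T} u∈X u∉T) , (v , ∖⁺ {W} {X} v∈W v∉X)) , ρX≡l
    where
    open CutPair pair
    X Y : VertexSet
    X = tabulate (λ x → if does (x ≟ v) then false else x ∈ᵇ W)
    Y = tabulate (λ x → if does (x ≟ v) then true else x ∈ᵇ T)
    v∈W : v ∈ᵇ W ≡ true
    v∈W = proj₁ (∖⁻ W T v v∈W∖T)
    v∉T : v ∈ᵇ T ≡ false
    v∉T = proj₂ (∖⁻ W T v v∈W∖T)
    u∉T : u ∈ᵇ T ≡ false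
    u∉T = proj₂ (∖⁻ W T u u∈W∖T)

    memberships : ∀ x → (x ∈ᵇ W ≡ (x ∈ᵇ X ∨ x ∈ᵇ Y)) × (x ∈ᵇ T ≡ (x ∈ᵇ X ∧ x ∈ᵇ Y))
                      × ((x ∈ᵇ X) xor (x ∈ᵇ Y) ≡ true → (W ∖ T) x ≡ true)
    memberships x rewrite lookup∘tabulate (λ x → if does (x ≟ v) then false else x ∈ᵇ W) x
                        | lookup∘tabulate (λ x → if does (x ≟ v) then true else x ∈ᵇ T) x
      with x ≟ v
    ... | yes refl = v∈W , v∉T , λ _ → v∈W∖T
    ... | no  _    = nested-bits (x ∈ᵇ W) (x ∈ᵇ T) (nested x)
      where
      nested-bits : ∀ w t → (t ≡ true → w ≡ true)
        → (w ≡ (w ∨ t)) × (t ≡ (w ∧ t)) × (w xor t ≡ true → w ∧ not t ≡ true)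
      nested-bits true  true  _ = refl , refl , λ ()
      nested-bits true  false _ = refl , refl , λ _ → refl
      nested-bits false true  h = ⊥-elim (true≢false (h refl) refl)
      nested-bits false false _ = refl , refl , λ ()

    W≡X∪Y : ∀ x → x ∈ᵇ W ≡ (x ∈ᵇ X ∨ x ∈ᵇ Y)
    W≡X∪Y x = proj₁ (memberships x)
    T≡X∩Y : ∀ x → x ∈ᵇ T ≡ (x ∈ᵇ X ∧ x ∈ᵇ Y)
    T≡X∩Y x = proj₁ (proj₂ (memberships x))

    T⊆X : T ⊆ˢ X
    T⊆X x x∈T = proj₁ (∧-true⁻ (trans (sym (T≡X∩Y x)) x∈T))
    T⊆Y : T ⊆ˢ Y
    T⊆Y x x∈T = proj₂ (∧-true⁻ {x ∈ᵇ X} (trans (sym (T≡X∩Y x)) x∈T))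
    X⊆W : X ⊆ˢ W
    X⊆W x x∈X = trans (W≡X∪Y x) (∨-trueˡ (x ∈ᵇ Y) x∈X)
    Y⊆W : Y ⊆ˢ W
    Y⊆W x x∈Y = trans (W≡X∪Y x) (∨-trueʳ (x ∈ᵇ X) x∈Y)

    u∈X : u ∈ᵇ X ≡ true
    u∈X rewrite lookup∘tabulate (λ x → if does (x ≟ v) then false else x ∈ᵇ W) u with u ≟ v
    ... | yes u≡v = ⊥-elim (u≢v u≡v)
    ... | no  _   = proj₁ (∖⁻ W T u u∈W∖T)
    v∉X : v ∈ᵇ X ≡ false
    v∉X rewrite lookup∘tabulate (λ x → if does (x ≟ v) then false else x ∈ᵇ W) v with v ≟ v
    ... | yes _   = refl
    ... | no  v≢v = ⊥-elim (v≢v refl)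

    no-crossing : ∀ f → E f ≡ true → (tl D f ∈ᵇ X) xor (tl D f ∈ᵇ Y) ≡ true
                                   → (hd D f ∈ᵇ X) xor (hd D f ∈ᵇ Y) ≡ true → ⊥
    no-crossing f Ef tl-differs hd-differs = no-internal f
      (Ef , proj₂ (proj₂ (memberships (tl D f))) tl-differs , proj₂ (proj₂ (memberships (hd D f))) hd-differs)

    ρX≡l : ρ E X ≡ l
    ρX≡l = half-of-sum (cut X T⊆X X⊆W) (cut Y T⊆Y Y⊆W)
             (trans (ρ-modular E X Y W T W≡X∪Y T≡X∩Y no-crossing) (cong₂ _+_ ρW≡l ρT≡l))

  linkage-exists : ∀ bound {E W T l} → count E + count (W ∖ T) < bound
    → CutPair E W T l → ∃ (Linkage E W T)
  linkage-exists (suc bound) {E} {W} {T} {l} small pair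
    with anySubset? (tight-between? E W T l)
  ... | yes (Y , tight@(between@(T⊆Y , Y⊆W , _) , _)) =
    let (pairWY , pairYT) = split-pair {E} {W} {T} {l} {Y} pair tight
        (gapWY , gapYT)   = between-smaller {W} {T} {Y} between
        (PA , LA) = linkage-exists bound (smaller (+-monoʳ-< (count E) gapWY)) pairWY
        (PB , LB) = linkage-exists bound (smaller (+-monoʳ-< (count E) gapYT)) pairYT
    in _ , concat-linkage {E} {W} {Y} {T} T⊆Y Y⊆W LA LB
    where
    smaller : ∀ {k} → k < count E + count (W ∖ T) → k < bound
    smaller k< = <-≤-trans k< (≤-pred small)
  ... | no no-tight with any? (internal? E W T)
  ...   | yes (f , f-internal@(Ef , tl∈W∖T , _)) =
    let (P , L) = linkage-exists bound fewer-edges (delete-pair {E} {W} {T} {l} {f} pair no-tight f-internal)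
    in P , linkage-restrict (λ e h → proj₁ (─⁻ E e f h)) still-entering L
    where
    fewer-edges : count (E ─ f) + count (W ∖ T) < bound
    fewer-edges = <-≤-trans (+-monoˡ-< (count (W ∖ T)) E─f<E) (≤-pred small)
      where
      E─f<E : count (E ─ f) < count E
      E─f<E = subst (count (E ─ f) <_) (sym (count-remove E Ef)) (n<1+n _)
    still-entering : ∀ e → enters E W e ≡ true → enters (E ─ f) W e ≡ true
    still-entering e e∈in = let (Ee , tl∉W , hd∈W) = enters⁻ E W e e∈in in
      enters⁺ {E ─ f} {W} (─⁺ E e f Ee (λ { refl → true≢false (proj₁ (∖⁻ W T _ tl∈W∖T)) tl∉W }))
              tl∉W hd∈W
  ...   | no no-internal
    with any? (λ u → any? (λ v → ((W ∖ T) u Bool.≟ true) ×-dec ((W ∖ T) v Bool.≟ true) ×-dec ¬? (u ≟ v)))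
  ...     | yes (u , v , u∈ , v∈ , u≢v) =
    ⊥-elim (no-tight (two-vertices {E} {W} {T} {l} pair (λ f f-internal → no-internal (f , f-internal))
                                   u v u∈ v∈ u≢v))
  ...     | no no-two = small-linkage nested (trans ρW≡l (sym ρT≡l)) at-most-one
    where
    open CutPair pair
    at-most-one : ∀ x y → (W ∖ T) x ≡ true → (W ∖ T) y ≡ true → x ≡ y
    at-most-one x y x∈ y∈ with x ≟ y
    ... | yes x≡y = x≡y
    ... | no  x≢y = ⊥-elim (no-two (x , y , x∈ , y∈ , x≢y))

disjoint-antitone : ∀ {p} (A X Y : Subset p) → Y ⊆ˢ X → A ∩ X ≡ ∅ → A ∩ Y ≡ ∅
disjoint-antitone A X Y Y⊆X A∩X≡∅ = ⊆-antisym A∩Y⊆∅ (⊆-min (A ∩ Y))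
  where
  A∩Y⊆∅ : A ∩ Y ⊆ᴸ ∅
  A∩Y⊆∅ {x} x∈A∩Y =
    let (x∈A , x∈Y) = x∈p∩q⁻ A Y x∈A∩Y in
    subst (x ∈ᴸ_) A∩X≡∅ (x∈p∩q⁺ (x∈A , lookup⇒[]= x X (Y⊆X x ([]=⇒lookup x∈Y))))

module Branchings (D : Digraph) {k : ℕ} (Vb : Fin k → Subset (n D)) (Ab : Fin k → Subset (m D)) where
  open Linkages D

  ϱ≡ρ : ∀ X → ϱ D Vb Ab X ≡ ρ (remB D Vb Ab) X
  ϱ≡ρ X = count-tabulate (inB D Vb Ab X)

  missing-antitone : ∀ {X Y} → Y ⊆ˢ X → missing D Vb Ab X ≤ missing D Vb Ab Y
  missing-antitone {X} {Y} Y⊆X =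
    subst₂ _≤_ (sym (count-tabulate (misses X))) (sym (count-tabulate (misses Y))) (count-mono misses-Y)
    where
    misses : Subset (n D) → Fin k → Bool
    misses Z i = does (≡-dec Bool._≟_ (Vb i ∩ Z) ∅)
    misses-Y : ∀ i → misses X i ≡ true → misses Y i ≡ true
    misses-Y i h with ≡-dec Bool._≟_ (Vb i ∩ X) ∅ | ≡-dec Bool._≟_ (Vb i ∩ Y) ∅
    ... | _         | yes _    = refl
    ... | yes V∩X≡∅ | no V∩Y≢∅ = ⊥-elim (V∩Y≢∅ (disjoint-antitone (Vb i) X Y Y⊆X V∩X≡∅))

  -- Under the cut condition, a tight set B0 and a nonempty B1 ⊆ B0 with
  -- ϱ(B0) = ϱ(B1) = l form a cut pair: every Y between them has
  -- ϱ(Y) ≥ missing(Y) ≥ missing(B0) = ϱ(B0) = l.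
  tight-cutPair : ∀ {B0 B1 l} → CutCondition D Vb Ab → Tight D Vb Ab B0 → NonEmpty B1 → B1 ⊆ˢ B0
    → ϱ D Vb Ab B0 ≡ l → ϱ D Vb Ab B1 ≡ l → CutPair (remB D Vb Ab) B0 B1 l
  tight-cutPair {B0} {B1} {l} cut-condition (_ , ϱ≡missing) (x , x∈B1) B1⊆B0 ϱB0≡l ϱB1≡l = record
    { nested = B1⊆B0
    ; ρW≡l   = trans (sym (ϱ≡ρ B0)) ϱB0≡l
    ; ρT≡l   = trans (sym (ϱ≡ρ B1)) ϱB1≡l
    ; cut    = λ Y B1⊆Y Y⊆B0 → subst (l ≤_) (ϱ≡ρ Y)
                 (≤-trans (≤-reflexive (trans (sym ϱB0≡l) ϱ≡missing))
                   (≤-trans (missing-antitone Y⊆B0) (cut-condition Y (x , B1⊆Y x x∈B1))))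
    }

  hits⇒meets : ∀ T s es → HitsOnlyAtEnd D Vb Ab T s es → MeetsOnlyAtEnd T s es
  hits⇒meets T s []       s∈T          = s∈T
  hits⇒meets T s (e ∷ es) (s∉T , hits) = s∉T , hits⇒meets T (hd D e) es hits

  meets⇒hits : ∀ T s es → MeetsOnlyAtEnd T s es → HitsOnlyAtEnd D Vb Ab T s es
  meets⇒hits T s []       s∈T           = s∈T
  meets⇒hits T s (e ∷ es) (s∉T , meets) = s∉T , meets⇒hits T (hd D e) es meets

  pathSystem⇒linkage : ∀ {B0 B1 P} → PathSystem D Vb Ab B0 B1 P → Linkage (remB D Vb Ab) B0 B1 P
  pathSystem⇒linkage {B1 = B1} {P} (paths , disjoint) = record
    { path = λ e e∈in → let (chain , usesE , insideW , simple , hits) = paths e e∈in in record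
               { chain = chain ; usesE = usesE ; insideW = insideW ; simple = simple
               ; meetsT = hits⇒meets B1 (hd D e) (P e) hits }
    ; disjoint = disjoint }

  linkage⇒pathSystem : ∀ {B0 B1 P} → Linkage (remB D Vb Ab) B0 B1 P → PathSystem D Vb Ab B0 B1 P
  linkage⇒pathSystem {B1 = B1} {P} L =
    (λ e e∈in → let open Path (path e e∈in) in
                chain , usesE , insideW , simple , meets⇒hits B1 (hd D e) (P e) meetsT) ,
    disjoint
    where open Linkage L

  pathSystem-exists : ∀ {B0 B1 l} → CutPair (remB D Vb Ab) B0 B1 l → ∃ (PathSystem D Vb Ab B0 B1)
  pathSystem-exists pair = let (P , L) = linkage-exists _ (n<1+n _) pair in P , linkage⇒pathSystem L

  pathSystem-rigid : ∀ {B0 B1 P} → B1 ⊆ˢ B0 → ϱ D Vb Ab B1 ≤ ϱ D Vb Ab B0 → PathSystem D Vb Ab B0 B1 P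
    → (∀ f → remB D Vb Ab f ≡ true → tl D f ∈ᵇ B0 ≡ true → tl D f ∈ᵇ B1 ≡ false
         → hd D f ∈ᵇ B1 ≡ true → ∃ λ e → inB D Vb Ab B0 e ≡ true × f ∈ P e)
    × (∀ v → endMult D Vb Ab B0 P v ≡ headMult D Vb Ab B1 v)
  pathSystem-rigid {B0} {B1} {P} B1⊆B0 ϱB1≤ϱB0 S = proj₁ (linkage-rigid B1⊆B0 ρB1≤ρB0 L) , multiplicities
    where
    L : Linkage (remB D Vb Ab) B0 B1 P
    L = pathSystem⇒linkage {B0} {B1} {P} S
    ρB1≤ρB0 : ρ (remB D Vb Ab) B1 ≤ ρ (remB D Vb Ab) B0
    ρB1≤ρB0 = subst₂ _≤_ (ϱ≡ρ B1) (ϱ≡ρ B0) ϱB1≤ϱB0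
    multiplicities : ∀ v → endMult D Vb Ab B0 P v ≡ headMult D Vb Ab B1 v
    multiplicities v = begin
      endMult D Vb Ab B0 P v
        ≡⟨ count-tabulate (λ e → inB D Vb Ab B0 e ∧ does (endW D (hd D e) (P e) ≟ v)) ⟩
      count (λ e → inB D Vb Ab B0 e ∧ does (endW D (hd D e) (P e) ≟ v))
        ≡⟨ proj₂ (linkage-rigid B1⊆B0 ρB1≤ρB0 L) v ⟩
      count (λ f → inB D Vb Ab B1 f ∧ does (hd D f ≟ v))
        ≡⟨ count-tabulate (λ f → inB D Vb Ab B1 f ∧ does (hd D f ≟ v)) ⟨
      headMult D Vb Ab B1 v ∎
      where open ≡-Reasoning

corollary2 : (D : Digraph) (k : ℕ) (Vb : Fin k → Subset (n D)) (Ab : Fin k → Subset (m D))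
    → EdgeDisjointBranchings D Vb Ab
    → CutCondition D Vb Ab
    → (B0 B1 : Subset (n D)) (l : ℕ)
    → Dangerous D Vb Ab B0 → Dangerous D Vb Ab B1 → B1 ⊆ˢ B0
    → ϱ D Vb Ab B0 ≡ l → ϱ D Vb Ab B1 ≡ l → 1 ≤ l
    → (∃ λ (P : Fin (m D) → List (Fin (m D))) → PathSystem D Vb Ab B0 B1 P)
      × (∀ P → PathSystem D Vb Ab B0 B1 P
           → (∀ f → remB D Vb Ab f ≡ true → tl D f ∈ᵇ B0 ≡ true → tl D f ∈ᵇ B1 ≡ false
                → hd D f ∈ᵇ B1 ≡ true
                → Σ (Fin (m D)) λ e → (inB D Vb Ab B0 e ≡ true) × (f ∈ P e))
           × (∀ v → endMult D Vb Ab B0 P v ≡ headMult D Vb Ab B1 v))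
corollary2 D _ Vb Ab _ cut-condition B0 B1 l (B0-tight , _) (B1-tight , _) B1⊆B0 ϱB0≡l ϱB1≡l _ =
  pathSystem-exists pair ,
  λ P → pathSystem-rigid {B0} {B1} {P} B1⊆B0 (≤-reflexive (trans ϱB1≡l (sym ϱB0≡l)))
  where
  open Linkages D
  open Branchings D Vb Ab
  pair : CutPair (remB D Vb Ab) B0 B1 l
  pair = tight-cutPair cut-condition B0-tight (proj₁ B1-tight) B1⊆B0 ϱB0≡l ϱB1≡l
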